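{- Let $(a_i)_{i\ge0}$ be given by $a_i=F(2i+1)$, where $F$ is the Fibonacci sequence with $F(1)=F(2)=1$ (so $(a_i)=(1,2,5,13,34,\dots)$). A nonnegative integer $n$ lies in $W_U=\{\lfloor m\phi^2\rfloor\mid m\geq0\}$ (where $\phi=\frac{1+\sqrt5}2$) if and only if $n$ is a non-volatile zend with respect to the $(a_i)$-representation.
   Context: For $n\ge1$ with $a_j\le n<a_{j+1}$, the $(a_i)$-representation of $n$ is the digit string $d_j\cdots d_0$ with $n=\sum d_ia_i$ and $\sum d_i$ minimal (greedy: $d_j=\lfloor n/a_j\rfloor$, then recursively $n \bmod a_j$); the representation of $0$ is the digit $0$. $n$ is a zend if its representation ends in the digit $0$; $n\ge0$ is non-volatile if the representation of $n+1$ does not end in $0$. -}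

module Defs where

open import Data.Nat using (ℕ; zero; suc; _+_; _*_; _∸_; _^_; _≤_; _<_; _/_; _%_; _≤ᵇ_; NonZero; >-nonZero; z<s)
open import Data.Nat.Properties using (≤-trans; m≤m+n)
open import Data.List using (List; []; _∷_)
open import Data.Bool using (if_then_else_)
open import Data.Sum using (_⊎_)
open import Data.Product using (∃; _×_)
open import Relation.Nullary using (¬_)
open import Relation.Binary.PropositionalEquality using (_≡_)

fib : ℕ → ℕ
fib zero = 0
fib (suc zero) = 1
fib (suc (suc n)) = fib (suc n) + fib n

fib-suc-pos : ∀ k → 0 < fib (suc k)
fib-suc-pos zero = z<s
fib-suc-pos (suc k) = ≤-trans (fib-suc-pos k) (m≤m+n (fib (suc k)) (fib k))

a : ℕ → ℕ
a i = fib (suc (2 * i))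

a-nonZero : ∀ i → NonZero (a i)
a-nonZero i = >-nonZero (fib-suc-pos (2 * i))

findTop : ℕ → ℕ → ℕ
findTop zero n = 0
findTop (suc j) n = if a (suc j) ≤ᵇ n then suc j else findTop j n

-- for n ≥ 1: the index j with a_j ≤ n < a_{j+1} (note a_j > j, so j ≤ n)
top : ℕ → ℕ
top n = findTop n n

digitsFrom : ℕ → ℕ → List ℕ
digitsFrom zero r = ((r / a zero) {{a-nonZero zero}}) ∷ []
digitsFrom (suc j) r =
  ((r / a (suc j)) {{a-nonZero (suc j)}})
    ∷ digitsFrom j ((r % a (suc j)) {{a-nonZero (suc j)}})

-- the (a_i)-representation of n (most significant digit first);
-- the representation of 0 is the single digit 0
rep : ℕ → List ℕ
rep zero = 0 ∷ []
rep (suc n) = digitsFrom (top (suc n)) (suc n)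

lastDigit : List ℕ → ℕ
lastDigit [] = 0
lastDigit (d ∷ []) = d
lastDigit (d ∷ e ∷ ds) = lastDigit (e ∷ ds)

Zend : ℕ → Set
Zend n = lastDigit (rep n) ≡ 0

NonVolatile : ℕ → Set
NonVolatile n = ¬ (lastDigit (rep (suc n)) ≡ 0)

-- "k ≤ m·φ²" where φ² = (3+√5)/2, i.e. 2k - 3m ≤ m√5, written in exact
-- integer arithmetic: either 2k ≤ 3m, or (2k-3m)² ≤ 5m².
LeMulPhiSq : ℕ → ℕ → Set
LeMulPhiSq k m = (2 * k ≤ 3 * m) ⊎ ((2 * k ∸ 3 * m) ^ 2 ≤ 5 * m ^ 2)

IsFloorMulPhiSq : ℕ → ℕ → Set
IsFloorMulPhiSq n m = LeMulPhiSq n m × ¬ LeMulPhiSq (suc n) m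

InWU : ℕ → Set
InWU n = ∃ λ m → IsFloorMulPhiSq n m

module Submission where

-- Let T be the number whose greedy (aᵢ)-digits are those of n moved one place down (aᵢ ↦ aᵢ₋₁ for
-- i ≥ 1). Since aᵢ₋₁φ² − aᵢ = φ^(1−2i), the error Tφ² − n equals d₀φ + Σᵢ≥₁ dᵢφ^(1−2i), and an
-- induction on the number of digits places it in [0, 1) when n is a non-volatile zend, in [1, φ)
-- when n is a volatile zend and in [φ, φ²) otherwise. In the first case n = ⌊Tφ²⌋; in the
-- others Tφ² ∈ [n + 1, n + φ²), so no multiple of φ² lies in [n, n + 1).

open import Defs
open import Data.Nat as ℕ using (ℕ; zero; suc; z≤n; s≤s; _∸_; _^_)
import Data.Nat.Properties as ℕₚ
import Data.Nat.DivMod as DivMod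
import Data.Nat.Tactic.RingSolver as ℕ-Solver
open import Data.Integer as ℤ using (ℤ; +_; 0ℤ; _+_; _-_; _*_; _≤_; _<_; +≤+; +<+)
import Data.Integer.Properties as ℤₚ
import Data.Integer.Tactic.RingSolver as ℤ-Solver
open import Data.Product using (∃; _×_; _,_; proj₁; proj₂; map)
open import Data.Sum using (inj₁; inj₂)
open import Data.Bool using (true; false; T)
open import Data.Empty using (⊥; ⊥-elim)
open import Data.List using ([]; _∷_)
open import Function using (_∘_)
open import Function.Bundles using (_⇔_; mk⇔; Equivalence)
open import Relation.Nullary using (¬_; yes; no; Dec)
open import Relation.Nullary.Decidable using (_⊎-dec_)
open import Relation.Binary.PropositionalEquality
  using (_≡_; _≢_; _≗_; refl; sym; trans; cong; cong₂; subst; subst₂; module ≡-Reasoning)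

evenFib : ℕ → ℕ
evenFib j = fib (2 ℕ.* j)

evenFib-suc : ∀ j → evenFib (suc j) ≡ a j ℕ.+ evenFib j
evenFib-suc j = cong fib (ℕₚ.*-suc 2 j)

a-suc : ∀ j → a (suc j) ≡ evenFib (suc j) ℕ.+ a j
a-suc j = trans (cong (fib ∘ suc) (ℕₚ.*-suc 2 j)) (cong (λ k → fib k ℕ.+ a j) (sym (ℕₚ.*-suc 2 j)))

a-pos : ∀ j → 0 ℕ.< a j
a-pos j = fib-suc-pos (2 ℕ.* j)

evenFib-suc-pos : ∀ j → 0 ℕ.< evenFib (suc j)
evenFib-suc-pos j = subst (0 ℕ.<_) (sym (evenFib-suc j)) (ℕₚ.<-≤-trans (a-pos j) (ℕₚ.m≤m+n (a j) (evenFib j)))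

evenFib≤a : ∀ j → evenFib j ℕ.≤ a j
evenFib≤a zero = z≤n
evenFib≤a (suc j) = subst (evenFib (suc j) ℕ.≤_) (sym (a-suc j)) (ℕₚ.m≤m+n (evenFib (suc j)) (a j))

≤evenFib : ∀ j → j ℕ.≤ evenFib j
≤evenFib zero = z≤n
≤evenFib (suc j) = subst (suc j ℕ.≤_) (sym (evenFib-suc j)) (ℕₚ.+-mono-≤ (a-pos j) (≤evenFib j))

a-<-suc : ∀ j → a j ℕ.< a (suc j)
a-<-suc j = subst (a j ℕ.<_) (sym (a-suc j)) (ℕₚ.m<n+m (a j) (evenFib-suc-pos j))

<a : ∀ n → n ℕ.< a n
<a zero = a-pos 0
<a (suc n) = ℕₚ.≤-<-trans (<a n) (a-<-suc n)

a-suc-suc : ∀ j → a (suc (suc j)) ≡ evenFib (suc j) ℕ.+ 2 ℕ.* a (suc j)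
a-suc-suc j = begin
  a (suc (suc j))                                ≡⟨ a-suc (suc j) ⟩
  evenFib (suc (suc j)) ℕ.+ a (suc j)            ≡⟨ cong (ℕ._+ a (suc j)) (evenFib-suc (suc j)) ⟩
  a (suc j) ℕ.+ evenFib (suc j) ℕ.+ a (suc j)    ≡⟨ regroup (a (suc j)) (evenFib (suc j)) ⟩
  evenFib (suc j) ℕ.+ 2 ℕ.* a (suc j)            ∎
  where
  open ≡-Reasoning
  regroup : ∀ x y → x ℕ.+ y ℕ.+ x ≡ y ℕ.+ 2 ℕ.* x
  regroup = ℕ-Solver.solve-∀

cassini : ∀ j → a j ℕ.* a j ≡ a j ℕ.* evenFib j ℕ.+ evenFib j ℕ.* evenFib j ℕ.+ 1
cassini zero = refl
cassini (suc j) rewrite a-suc j | evenFib-suc j = step (a j) (evenFib j) (cassini j)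
  where
  open ℕ-Solver
  open ≡-Reasoning
  step : ∀ x y → x ℕ.* x ≡ x ℕ.* y ℕ.+ y ℕ.* y ℕ.+ 1 →
         (x ℕ.+ y ℕ.+ x) ℕ.* (x ℕ.+ y ℕ.+ x) ≡
         (x ℕ.+ y ℕ.+ x) ℕ.* (x ℕ.+ y) ℕ.+ (x ℕ.+ y) ℕ.* (x ℕ.+ y) ℕ.+ 1
  step x y c = begin
    (x ℕ.+ y ℕ.+ x) ℕ.* (x ℕ.+ y ℕ.+ x)
      ≡⟨ solve (x ∷ y ∷ []) ⟩
    3 ℕ.* (x ℕ.* x) ℕ.+ 4 ℕ.* (x ℕ.* y) ℕ.+ y ℕ.* y ℕ.+ x ℕ.* x
      ≡⟨ cong (3 ℕ.* (x ℕ.* x) ℕ.+ 4 ℕ.* (x ℕ.* y) ℕ.+ y ℕ.* y ℕ.+_) c ⟩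
    3 ℕ.* (x ℕ.* x) ℕ.+ 4 ℕ.* (x ℕ.* y) ℕ.+ y ℕ.* y ℕ.+ (x ℕ.* y ℕ.+ y ℕ.* y ℕ.+ 1)
      ≡⟨ solve (x ∷ y ∷ []) ⟩
    (x ℕ.+ y ℕ.+ x) ℕ.* (x ℕ.+ y) ℕ.+ (x ℕ.+ y) ℕ.* (x ℕ.+ y) ℕ.+ 1 ∎

lucas-square : ∀ x y L → L ℕ.+ y ≡ 2 ℕ.* x → x ℕ.* x ≡ x ℕ.* y ℕ.+ y ℕ.* y ℕ.+ 1 →
               L ℕ.* L ≡ 5 ℕ.* (y ℕ.* y) ℕ.+ 4
lucas-square x y L L+y≡2x c = ℕₚ.+-cancelʳ-≡ (2 ℕ.* y ℕ.* L ℕ.+ y ℕ.* y) _ _ (begin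
  L ℕ.* L ℕ.+ (2 ℕ.* y ℕ.* L ℕ.+ y ℕ.* y)                 ≡⟨ solve (L ∷ y ∷ []) ⟩
  (L ℕ.+ y) ℕ.* (L ℕ.+ y)                                 ≡⟨ cong (λ z → z ℕ.* z) L+y≡2x ⟩
  (2 ℕ.* x) ℕ.* (2 ℕ.* x)                                 ≡⟨ solve (x ∷ []) ⟩
  4 ℕ.* (x ℕ.* x)                                         ≡⟨ cong (4 ℕ.*_) c ⟩
  4 ℕ.* (x ℕ.* y ℕ.+ y ℕ.* y ℕ.+ 1)                       ≡⟨ solve (x ∷ y ∷ []) ⟩
  2 ℕ.* y ℕ.* (2 ℕ.* x) ℕ.+ 4 ℕ.* (y ℕ.* y) ℕ.+ 4         ≡⟨ cong (λ z → 2 ℕ.* y ℕ.* z ℕ.+ 4 ℕ.* (y ℕ.* y) ℕ.+ 4) L+y≡2x ⟨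
  2 ℕ.* y ℕ.* (L ℕ.+ y) ℕ.+ 4 ℕ.* (y ℕ.* y) ℕ.+ 4         ≡⟨ solve (L ∷ y ∷ []) ⟩
  5 ℕ.* (y ℕ.* y) ℕ.+ 4 ℕ.+ (2 ℕ.* y ℕ.* L ℕ.+ y ℕ.* y)   ∎)
  where
  open ℕ-Solver
  open ≡-Reasoning

lucas : ∀ j → ∃ λ L → L ℕ.+ evenFib j ≡ 2 ℕ.* a j × L ℕ.* L ≡ 5 ℕ.* (evenFib j ℕ.* evenFib j) ℕ.+ 4
lucas j = L , L+e≡2a , lucas-square (a j) (evenFib j) L L+e≡2a (cassini j)
  where
  L = 2 ℕ.* a j ∸ evenFib j
  L+e≡2a : L ℕ.+ evenFib j ≡ 2 ℕ.* a j
  L+e≡2a = ℕₚ.m∸n+n≡m (ℕₚ.≤-trans (evenFib≤a j) (ℕₚ.m≤m+n (a j) (a j ℕ.+ 0)))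

Seq : Set
Seq = ℕ → ℤ

Eventually : (ℕ → Set) → Set
Eventually P = ∃ λ N → ∀ i → N ℕ.≤ i → P i

private variable
  P Q R : ℕ → Set

always : (∀ i → P i) → Eventually P
always p = 0 , λ i _ → p i

mapᵉ : (∀ {i} → P i → Q i) → Eventually P → Eventually Q
mapᵉ f (N , p) = N , λ i N≤i → f (p i N≤i)

zipWithᵉ : (∀ {i} → P i → Q i → R i) → Eventually P → Eventually Q → Eventually R
zipWithᵉ f (M , p) (N , q) = M ℕ.⊔ N , λ i M⊔N≤i →
  f (p i (ℕₚ.m⊔n≤o⇒m≤o M N M⊔N≤i)) (q i (ℕₚ.m⊔n≤o⇒n≤o M N M⊔N≤i))

never : (∀ {i} → P i → ⊥) → ¬ Eventually P
never ¬p (N , p) = ¬p (p N ℕₚ.≤-refl)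

infix 4 _≤ᵉ_ _<ᵉ_
infixl 6 _⊕_ _⊖_
infixr 7 _·_

_≤ᵉ_ _<ᵉ_ : Seq → Seq → Set
X ≤ᵉ Y = Eventually λ i → X i ≤ Y i
X <ᵉ Y = Eventually λ i → X i < Y i

0ˢ : Seq
0ˢ _ = 0ℤ

_⊕_ _⊖_ : Seq → Seq → Seq
(X ⊕ Y) i = X i + Y i
(X ⊖ Y) i = X i - Y i

_·_ : ℕ → Seq → Seq
(k · X) i = + k * X i

private variable
  X Y Z : Seq

≤ᵉ-reflexive : X ≗ Y → X ≤ᵉ Y
≤ᵉ-reflexive X≗Y = always λ i → ℤₚ.≤-reflexive (X≗Y i)

≤ᵉ-trans : X ≤ᵉ Y → Y ≤ᵉ Z → X ≤ᵉ Z
≤ᵉ-trans = zipWithᵉ ℤₚ.≤-trans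

≤ᵉ-<ᵉ-trans : X ≤ᵉ Y → Y <ᵉ Z → X <ᵉ Z
≤ᵉ-<ᵉ-trans = zipWithᵉ ℤₚ.≤-<-trans

<ᵉ-≤ᵉ-trans : X <ᵉ Y → Y ≤ᵉ Z → X <ᵉ Z
<ᵉ-≤ᵉ-trans = zipWithᵉ ℤₚ.<-≤-trans

<ᵉ⇒≤ᵉ : X <ᵉ Y → X ≤ᵉ Y
<ᵉ⇒≤ᵉ = mapᵉ ℤₚ.<⇒≤

<ᵉ⇒≱ᵉ : X <ᵉ Y → ¬ Y ≤ᵉ X
<ᵉ⇒≱ᵉ X<Y Y≤X = never (λ (x<y , y≤x) → ℤₚ.<⇒≱ x<y y≤x) (zipWithᵉ _,_ X<Y Y≤X)

-- Arithmetic in ℤ[φ] modelled by sequences: x · one ⊕ y · φ is i ↦ x F(2i) + y F(2i+1),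
-- which is asymptotic to (x + y φ) φ^(2i) / √5 and so eventually has the sign of x + y φ.

one φ φ² : Seq
one i = + evenFib i
φ i = + a i
φ² = φ ⊕ one

+evenFib-suc : ∀ j → + evenFib (suc j) ≡ + a j + + evenFib j
+evenFib-suc j = trans (cong +_ (evenFib-suc j)) (ℤₚ.pos-+ (a j) (evenFib j))

+a-suc : ∀ j → + a (suc j) ≡ + evenFib (suc j) + + a j
+a-suc j = trans (cong +_ (a-suc j)) (ℤₚ.pos-+ (evenFib (suc j)) (a j))

+[m+n]-+m≡+n : ∀ m n → + (m ℕ.+ n) - + m ≡ + n
+[m+n]-+m≡+n m n = trans (cong (_- + m) (ℤₚ.pos-+ m n)) (x+y-x≡y (+ m) (+ n))
  where
  x+y-x≡y : ∀ x y → x + y - x ≡ y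
  x+y-x≡y = ℤ-Solver.solve-∀

-- ε j and δ j model φ^(-2j) and φ^(-2j-1).
ε δ : ℕ → Seq
ε zero = one
ε (suc j) = ε j ⊖ δ j
δ zero = φ ⊖ one
δ (suc j) = δ j ⊖ ε (suc j)

εδ-value : ∀ j m → ε j (suc (j ℕ.+ m)) ≡ + evenFib (suc m) × δ j (suc (j ℕ.+ m)) ≡ + a m
εδ-value zero m = refl , a-value m
  where
  a-value : ∀ m → + a (suc m) - + evenFib (suc m) ≡ + a m
  a-value m = trans (cong (_- + evenFib (suc m)) (cong +_ (a-suc m))) (+[m+n]-+m≡+n (evenFib (suc m)) (a m))
εδ-value (suc j) m = ε-value , δ-value
  where
  open ≡-Reasoning
  shift : ∀ {X : Seq} → X (suc (suc (j ℕ.+ m))) ≡ X (suc (j ℕ.+ suc m))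
  shift {X} = cong (X ∘ suc) (sym (ℕₚ.+-suc j m))
  ε-value : ε (suc j) (suc (suc j ℕ.+ m)) ≡ + evenFib (suc m)
  ε-value = begin
    ε j (suc (suc (j ℕ.+ m))) - δ j (suc (suc (j ℕ.+ m)))
      ≡⟨ cong₂ _-_ (trans (shift {ε j}) (proj₁ (εδ-value j (suc m))))
                   (trans (shift {δ j}) (proj₂ (εδ-value j (suc m)))) ⟩
    + evenFib (suc (suc m)) - + a (suc m)
      ≡⟨ cong (_- + a (suc m)) (cong +_ (evenFib-suc (suc m))) ⟩
    + (a (suc m) ℕ.+ evenFib (suc m)) - + a (suc m)
      ≡⟨ +[m+n]-+m≡+n (a (suc m)) (evenFib (suc m)) ⟩
    + evenFib (suc m) ∎
  δ-value : δ (suc j) (suc (suc j ℕ.+ m)) ≡ + a m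
  δ-value = begin
    δ j (suc (suc (j ℕ.+ m))) - ε (suc j) (suc (suc j ℕ.+ m))
      ≡⟨ cong₂ _-_ (trans (shift {δ j}) (proj₂ (εδ-value j (suc m)))) ε-value ⟩
    + a (suc m) - + evenFib (suc m)
      ≡⟨ cong (_- + evenFib (suc m)) (cong +_ (a-suc m)) ⟩
    + (evenFib (suc m) ℕ.+ a m) - + evenFib (suc m)
      ≡⟨ +[m+n]-+m≡+n (evenFib (suc m)) (a m) ⟩
    + a m ∎

eventually-from-value : ∀ {X : Seq} j → (∀ m → 0ℤ < X (suc (j ℕ.+ m))) → 0ˢ <ᵉ X
eventually-from-value {X} j pos = suc j , λ i j<i →
  subst (λ i → 0ℤ < X i) (ℕₚ.m+[n∸m]≡n j<i) (pos (i ∸ suc j))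

ε-pos : ∀ j → 0ˢ <ᵉ ε j
ε-pos j = eventually-from-value j λ m →
  subst (0ℤ <_) (sym (proj₁ (εδ-value j m))) (+<+ (evenFib-suc-pos m))

δ-pos : ∀ j → 0ˢ <ᵉ δ j
δ-pos j = eventually-from-value j λ m →
  subst (0ℤ <_) (sym (proj₂ (εδ-value j m))) (+<+ (a-pos m))

εδ-coefficients : ∀ j → ε j ≗ a j · one ⊖ evenFib j · φ × δ j ≗ a j · φ ⊖ evenFib (suc j) · one
εδ-coefficients zero = (λ i → base₁ (one i) (φ i)) , (λ i → base₂ (one i) (φ i))
  where
  base₁ : ∀ o f → o ≡ + 1 * o - + 0 * f
  base₁ = ℤ-Solver.solve-∀
  base₂ : ∀ o f → f - o ≡ + 1 * f - + 1 * o
  base₂ = ℤ-Solver.solve-∀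
εδ-coefficients (suc j) = ε-coefficients , δ-coefficients
  where
  open ≡-Reasoning
  A = + a j
  E = + evenFib j
  E′ = + evenFib (suc j)
  ε-identity : ∀ A E E′ o f → (A * o - E * f) - (A * f - E′ * o) ≡ (E′ + A) * o - (A + E) * f
  ε-identity = ℤ-Solver.solve-∀
  δ-identity : ∀ A A′ E′ o f → (A * f - E′ * o) - (A′ * o - E′ * f) ≡ (E′ + A) * f - (A′ + E′) * o
  δ-identity = ℤ-Solver.solve-∀
  ε-coefficients : ε (suc j) ≗ a (suc j) · one ⊖ evenFib (suc j) · φ
  ε-coefficients i = begin
    ε j i - δ j i
      ≡⟨ cong₂ _-_ (proj₁ (εδ-coefficients j) i) (proj₂ (εδ-coefficients j) i) ⟩
    (A * one i - E * φ i) - (A * φ i - E′ * one i)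
      ≡⟨ ε-identity A E E′ (one i) (φ i) ⟩
    (E′ + A) * one i - (A + E) * φ i
      ≡⟨ cong₂ (λ x y → x * one i - y * φ i) (sym (+a-suc j)) (sym (+evenFib-suc j)) ⟩
    + a (suc j) * one i - E′ * φ i ∎
  δ-coefficients : δ (suc j) ≗ a (suc j) · φ ⊖ evenFib (suc (suc j)) · one
  δ-coefficients i = begin
    δ j i - ε (suc j) i
      ≡⟨ cong₂ _-_ (proj₂ (εδ-coefficients j) i) (ε-coefficients i) ⟩
    (A * φ i - E′ * one i) - (+ a (suc j) * one i - E′ * φ i)
      ≡⟨ δ-identity A (+ a (suc j)) E′ (one i) (φ i) ⟩
    (E′ + A) * φ i - (+ a (suc j) + E′) * one i
      ≡⟨ cong₂ (λ x y → x * φ i - y * one i) (sym (+a-suc j)) (sym (+evenFib-suc (suc j))) ⟩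
    + a (suc j) * φ i - + evenFib (suc (suc j)) * one i ∎

δ-gap : ∀ j → δ j ≗ a j · φ² ⊖ a (suc j) · one
δ-gap j i = begin
  δ j i                                    ≡⟨ proj₂ (εδ-coefficients j) i ⟩
  A * φ i - E′ * one i                     ≡⟨ identity A E′ (φ i) (one i) ⟩
  A * (φ i + one i) - (E′ + A) * one i     ≡⟨ cong (λ x → A * (φ i + one i) - x * one i) (sym (+a-suc j)) ⟩
  A * (φ i + one i) - + a (suc j) * one i  ∎
  where
  open ≡-Reasoning
  A = + a j
  E′ = + evenFib (suc j)
  identity : ∀ A E′ f o → A * f - E′ * o ≡ A * (f + o) - (E′ + A) * o
  identity = ℤ-Solver.solve-∀

-- Comparison with φ² = (3 + √5)/2, using L(2i)² = 5F(2i)² + 4 as a rational approximation of √5 F(2i)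

square-cancel-≤ : ∀ {x y} → x ℕ.* x ℕ.≤ y ℕ.* y → x ℕ.≤ y
square-cancel-≤ x²≤y² = ℕₚ.≮⇒≥ λ y<x → ℕₚ.<⇒≱ (ℕₚ.*-mono-< y<x y<x) x²≤y²

square-cancel-< : ∀ {x y} → x ℕ.* x ℕ.< y ℕ.* y → x ℕ.< y
square-cancel-< x²<y² = ℕₚ.≰⇒> λ y≤x → ℕₚ.<⇒≱ x²<y² (ℕₚ.*-mono-≤ y≤x y≤x)

≤-Lucas : ∀ {d m f L} → L ℕ.* L ≡ 5 ℕ.* (f ℕ.* f) ℕ.+ 4 →
          d ℕ.* d ℕ.≤ 5 ℕ.* (m ℕ.* m) → d ℕ.* f ℕ.≤ m ℕ.* L
≤-Lucas {d} {m} {f} {L} L² d²≤5m² = square-cancel-≤ (begin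
  (d ℕ.* f) ℕ.* (d ℕ.* f)                        ≡⟨ solve (d ∷ f ∷ []) ⟩
  (d ℕ.* d) ℕ.* (f ℕ.* f)                        ≤⟨ ℕₚ.*-monoˡ-≤ (f ℕ.* f) d²≤5m² ⟩
  5 ℕ.* (m ℕ.* m) ℕ.* (f ℕ.* f)                  ≤⟨ ℕₚ.m≤m+n _ (4 ℕ.* (m ℕ.* m)) ⟩
  5 ℕ.* (m ℕ.* m) ℕ.* (f ℕ.* f) ℕ.+ 4 ℕ.* (m ℕ.* m) ≡⟨ solve (m ∷ f ∷ []) ⟩
  (m ℕ.* m) ℕ.* (5 ℕ.* (f ℕ.* f) ℕ.+ 4)          ≡⟨ cong ((m ℕ.* m) ℕ.*_) L² ⟨
  (m ℕ.* m) ℕ.* (L ℕ.* L)                        ≡⟨ solve (m ∷ L ∷ []) ⟩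
  (m ℕ.* L) ℕ.* (m ℕ.* L)                        ∎)
  where
  open ℕ-Solver
  open ℕₚ.≤-Reasoning

<-Lucas : ∀ {d m f L} → L ℕ.* L ≡ 5 ℕ.* (f ℕ.* f) ℕ.+ 4 → 2 ℕ.* m ℕ.< f →
          5 ℕ.* (m ℕ.* m) ℕ.< d ℕ.* d → m ℕ.* L ℕ.< d ℕ.* f
<-Lucas {d} {m} {f} {L} L² 2m<f 5m²<d² = square-cancel-< (begin-strict
  (m ℕ.* L) ℕ.* (m ℕ.* L)                        ≡⟨ solve (m ∷ L ∷ []) ⟩
  (m ℕ.* m) ℕ.* (L ℕ.* L)                        ≡⟨ cong ((m ℕ.* m) ℕ.*_) L² ⟩
  (m ℕ.* m) ℕ.* (5 ℕ.* (f ℕ.* f) ℕ.+ 4)          ≡⟨ solve (m ∷ f ∷ []) ⟩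
  5 ℕ.* (m ℕ.* m) ℕ.* (f ℕ.* f) ℕ.+ (2 ℕ.* m) ℕ.* (2 ℕ.* m)
                                                 <⟨ ℕₚ.+-monoʳ-< _ (ℕₚ.*-mono-< 2m<f 2m<f) ⟩
  5 ℕ.* (m ℕ.* m) ℕ.* (f ℕ.* f) ℕ.+ f ℕ.* f      ≡⟨ solve (m ∷ f ∷ []) ⟩
  suc (5 ℕ.* (m ℕ.* m)) ℕ.* (f ℕ.* f)            ≤⟨ ℕₚ.*-monoˡ-≤ (f ℕ.* f) 5m²<d² ⟩
  (d ℕ.* d) ℕ.* (f ℕ.* f)                        ≡⟨ solve (d ∷ f ∷ []) ⟩
  (d ℕ.* f) ℕ.* (d ℕ.* f)                        ∎)
  where
  open ℕ-Solver
  open ℕₚ.≤-Reasoning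

twice-evenFib-suc : ∀ i → 2 ℕ.* evenFib (suc i) ≡ proj₁ (lucas i) ℕ.+ 3 ℕ.* evenFib i
twice-evenFib-suc i = begin
  2 ℕ.* evenFib (suc i)                ≡⟨ cong (2 ℕ.*_) (evenFib-suc i) ⟩
  2 ℕ.* (a i ℕ.+ evenFib i)            ≡⟨ ℕₚ.*-distribˡ-+ 2 (a i) (evenFib i) ⟩
  2 ℕ.* a i ℕ.+ 2 ℕ.* evenFib i        ≡⟨ cong (ℕ._+ 2 ℕ.* evenFib i) (proj₁ (proj₂ (lucas i))) ⟨
  L ℕ.+ evenFib i ℕ.+ 2 ℕ.* evenFib i  ≡⟨ ℕₚ.+-assoc L (evenFib i) (2 ℕ.* evenFib i) ⟩
  L ℕ.+ 3 ℕ.* evenFib i                ∎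
  where
  open ≡-Reasoning
  L = proj₁ (lucas i)

m^2≡m*m : ∀ x → x ^ 2 ≡ x ℕ.* x
m^2≡m*m x = cong (x ℕ.*_) (ℕₚ.*-identityʳ x)

LeMulPhiSq⇒≤ : ∀ k m → LeMulPhiSq k m → ∀ i → k ℕ.* evenFib i ℕ.≤ m ℕ.* evenFib (suc i)
LeMulPhiSq⇒≤ k m le i = ℕₚ.*-cancelˡ-≤ 2 (begin
  2 ℕ.* (k ℕ.* f)                     ≡⟨ ℕₚ.*-assoc 2 k f ⟨
  2 ℕ.* k ℕ.* f                       ≤⟨ ℕₚ.*-monoˡ-≤ f (ℕₚ.m≤n+m∸n (2 ℕ.* k) (3 ℕ.* m)) ⟩
  (3 ℕ.* m ℕ.+ d) ℕ.* f               ≡⟨ regroup d m f ⟩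
  d ℕ.* f ℕ.+ m ℕ.* (3 ℕ.* f)         ≤⟨ ℕₚ.+-monoˡ-≤ (m ℕ.* (3 ℕ.* f)) (df≤mL le) ⟩
  m ℕ.* L ℕ.+ m ℕ.* (3 ℕ.* f)         ≡⟨ ℕₚ.*-distribˡ-+ m L (3 ℕ.* f) ⟨
  m ℕ.* (L ℕ.+ 3 ℕ.* f)               ≡⟨ cong (m ℕ.*_) (twice-evenFib-suc i) ⟨
  m ℕ.* (2 ℕ.* evenFib (suc i))       ≡⟨ swap m (evenFib (suc i)) ⟩
  2 ℕ.* (m ℕ.* evenFib (suc i))       ∎)
  where
  open ℕₚ.≤-Reasoning
  f = evenFib i
  L = proj₁ (lucas i)
  d = 2 ℕ.* k ∸ 3 ℕ.* m
  regroup : ∀ d m f → (3 ℕ.* m ℕ.+ d) ℕ.* f ≡ d ℕ.* f ℕ.+ m ℕ.* (3 ℕ.* f)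
  regroup = ℕ-Solver.solve-∀
  swap : ∀ m x → m ℕ.* (2 ℕ.* x) ≡ 2 ℕ.* (m ℕ.* x)
  swap = ℕ-Solver.solve-∀
  df≤mL : LeMulPhiSq k m → d ℕ.* f ℕ.≤ m ℕ.* L
  df≤mL (inj₁ 2k≤3m) = subst (λ x → x ℕ.* f ℕ.≤ m ℕ.* L) (sym (ℕₚ.m≤n⇒m∸n≡0 2k≤3m)) z≤n
  df≤mL (inj₂ d²≤5m²) = ≤-Lucas {d} {m} (proj₂ (proj₂ (lucas i)))
    (subst₂ ℕ._≤_ (m^2≡m*m d) (cong (5 ℕ.*_) (m^2≡m*m m)) d²≤5m²)

¬LeMulPhiSq⇒> : ∀ k m → ¬ LeMulPhiSq k m → ∀ i → 2 ℕ.* m ℕ.< evenFib i →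
                m ℕ.* evenFib (suc i) ℕ.< k ℕ.* evenFib i
¬LeMulPhiSq⇒> k m nle i 2m<f = ℕₚ.*-cancelˡ-< 2 _ _ (begin-strict
  2 ℕ.* (m ℕ.* evenFib (suc i))       ≡⟨ swap m (evenFib (suc i)) ⟨
  m ℕ.* (2 ℕ.* evenFib (suc i))       ≡⟨ cong (m ℕ.*_) (twice-evenFib-suc i) ⟩
  m ℕ.* (L ℕ.+ 3 ℕ.* f)               ≡⟨ ℕₚ.*-distribˡ-+ m L (3 ℕ.* f) ⟩
  m ℕ.* L ℕ.+ m ℕ.* (3 ℕ.* f)         <⟨ ℕₚ.+-monoˡ-< (m ℕ.* (3 ℕ.* f)) mL<df ⟩
  d ℕ.* f ℕ.+ m ℕ.* (3 ℕ.* f)         ≡⟨ regroup d m f ⟨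
  (3 ℕ.* m ℕ.+ d) ℕ.* f               ≡⟨ cong (ℕ._* f) (ℕₚ.m+[n∸m]≡n (ℕₚ.<⇒≤ 3m<2k)) ⟩
  2 ℕ.* k ℕ.* f                       ≡⟨ ℕₚ.*-assoc 2 k f ⟩
  2 ℕ.* (k ℕ.* f)                     ∎)
  where
  open ℕₚ.≤-Reasoning
  f = evenFib i
  L = proj₁ (lucas i)
  d = 2 ℕ.* k ∸ 3 ℕ.* m
  regroup : ∀ d m f → (3 ℕ.* m ℕ.+ d) ℕ.* f ≡ d ℕ.* f ℕ.+ m ℕ.* (3 ℕ.* f)
  regroup = ℕ-Solver.solve-∀
  swap : ∀ m x → m ℕ.* (2 ℕ.* x) ≡ 2 ℕ.* (m ℕ.* x)
  swap = ℕ-Solver.solve-∀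
  3m<2k : 3 ℕ.* m ℕ.< 2 ℕ.* k
  3m<2k = ℕₚ.≰⇒> (nle ∘ inj₁)
  mL<df : m ℕ.* L ℕ.< d ℕ.* f
  mL<df = <-Lucas {d} {m} (proj₂ (proj₂ (lucas i))) 2m<f
    (subst₂ ℕ._<_ (cong (5 ℕ.*_) (m^2≡m*m m)) (m^2≡m*m d) (ℕₚ.≰⇒> (nle ∘ inj₂)))

·one : ∀ k i → (k · one) i ≡ + (k ℕ.* evenFib i)
·one k i = sym (ℤₚ.pos-* k (evenFib i))

·φ² : ∀ m i → (m · φ²) i ≡ + (m ℕ.* evenFib (suc i))
·φ² m i = begin
  + m * (+ a i + + evenFib i)      ≡⟨ cong (+ m *_) (ℤₚ.pos-+ (a i) (evenFib i)) ⟨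
  + m * + (a i ℕ.+ evenFib i)      ≡⟨ ℤₚ.pos-* m (a i ℕ.+ evenFib i) ⟨
  + (m ℕ.* (a i ℕ.+ evenFib i))    ≡⟨ cong (λ x → + (m ℕ.* x)) (evenFib-suc i) ⟨
  + (m ℕ.* evenFib (suc i))        ∎
  where open ≡-Reasoning

LeMulPhiSq⇒≤ᵉ : ∀ k m → LeMulPhiSq k m → k · one ≤ᵉ m · φ²
LeMulPhiSq⇒≤ᵉ k m le = always λ i →
  subst₂ _≤_ (sym (·one k i)) (sym (·φ² m i)) (+≤+ (LeMulPhiSq⇒≤ k m le i))

¬LeMulPhiSq⇒<ᵉ : ∀ k m → ¬ LeMulPhiSq k m → m · φ² <ᵉ k · one
¬LeMulPhiSq⇒<ᵉ k m nle = suc (2 ℕ.* m) , λ i 2m<i →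
  subst₂ _<_ (sym (·φ² m i)) (sym (·one k i))
    (+<+ (¬LeMulPhiSq⇒> k m nle i (ℕₚ.<-≤-trans 2m<i (≤evenFib i))))

LeMulPhiSq? : ∀ k m → Dec (LeMulPhiSq k m)
LeMulPhiSq? k m = (2 ℕ.* k ℕ.≤? 3 ℕ.* m) ⊎-dec ((2 ℕ.* k ∸ 3 ℕ.* m) ^ 2 ℕ.≤? 5 ℕ.* m ^ 2)

LeMulPhiSq⇔≤ᵉ : ∀ k m → LeMulPhiSq k m ⇔ k · one ≤ᵉ m · φ²
LeMulPhiSq⇔≤ᵉ k m = mk⇔ (LeMulPhiSq⇒≤ᵉ k m) from
  where
  from : k · one ≤ᵉ m · φ² → LeMulPhiSq k m
  from k≤mφ² with LeMulPhiSq? k m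
  ... | yes le = le
  ... | no nle = ⊥-elim (<ᵉ⇒≱ᵉ (¬LeMulPhiSq⇒<ᵉ k m nle) k≤mφ²)

¬LeMulPhiSq⇔<ᵉ : ∀ k m → (¬ LeMulPhiSq k m) ⇔ m · φ² <ᵉ k · one
¬LeMulPhiSq⇔<ᵉ k m = mk⇔ (¬LeMulPhiSq⇒<ᵉ k m) λ mφ²<k le → <ᵉ⇒≱ᵉ mφ²<k (LeMulPhiSq⇒≤ᵉ k m le)

IsFloorMulPhiSq⇔ : ∀ n m → IsFloorMulPhiSq n m ⇔ (n · one ≤ᵉ m · φ² × m · φ² <ᵉ suc n · one)
IsFloorMulPhiSq⇔ n m = mk⇔
  (λ (le , nle) → Equivalence.to (LeMulPhiSq⇔≤ᵉ n m) le , Equivalence.to (¬LeMulPhiSq⇔<ᵉ (suc n) m) nle)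
  (λ (le , lt) → Equivalence.from (LeMulPhiSq⇔≤ᵉ n m) le , Equivalence.from (¬LeMulPhiSq⇔<ᵉ (suc n) m) lt)

digit rest : ℕ → ℕ → ℕ
digit j r = (r ℕ./ a j) {{a-nonZero j}}
rest j r = (r ℕ.% a j) {{a-nonZero j}}

rest<a : ∀ j r → rest j r ℕ.< a j
rest<a j r = DivMod.m%n<n r (a j) {{a-nonZero j}}

rest+digit : ∀ j r → r ≡ rest j r ℕ.+ digit j r ℕ.* a j
rest+digit j r = DivMod.m≡m%n+[m/n]*n r (a j) {{a-nonZero j}}

rest-small : ∀ j {r} → r ℕ.< a j → rest j r ≡ r
rest-small j = DivMod.m<n⇒m%n≡m {{a-nonZero j}}

rest-suc-rest : ∀ j r → rest j (suc r) ≡ rest j (suc (rest j r))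
rest-suc-rest j r = trans (cong (rest j ∘ suc) (rest+digit j r))
  (DivMod.[m+kn]%n≡m%n (suc (rest j r)) (digit j r) (a j) {{a-nonZero j}})

rest-suc : ∀ j r → suc (rest j r) ℕ.< a j → rest j (suc r) ≡ suc (rest j r)
rest-suc j r small = trans (rest-suc-rest j r) (rest-small j small)

rest-suc-wrap : ∀ j r → suc (rest j r) ≡ a j → rest j (suc r) ≡ 0
rest-suc-wrap j r wrap = trans (rest-suc-rest j r) (trans (cong (rest j) wrap) (DivMod.n%n≡0 (a j) {{a-nonZero j}}))

lastDigitFrom : ℕ → ℕ → ℕ
lastDigitFrom zero r = r
lastDigitFrom (suc j) r = lastDigitFrom j (rest (suc j) r)

lastDigit-digitsFrom : ∀ j r → lastDigit (digitsFrom j r) ≡ lastDigitFrom j r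
lastDigit-digitsFrom zero r = DivMod.n/1≡n r
lastDigit-digitsFrom (suc zero) r = lastDigit-digitsFrom zero (rest 1 r)
lastDigit-digitsFrom (suc (suc j)) r = lastDigit-digitsFrom (suc j) (rest (suc (suc j)) r)

lastDigitFrom-suc-small : ∀ j {r} → r ℕ.< a (suc j) → lastDigitFrom (suc j) r ≡ lastDigitFrom j r
lastDigitFrom-suc-small j r<a = cong (lastDigitFrom j) (rest-small (suc j) r<a)

lastDigitFrom-zero : ∀ j → lastDigitFrom j 0 ≡ 0
lastDigitFrom-zero zero = refl
lastDigitFrom-zero (suc j) = trans (lastDigitFrom-suc-small j (a-pos (suc j))) (lastDigitFrom-zero j)

lastDigitFrom-findTop : ∀ j n → lastDigitFrom (findTop j n) n ≡ lastDigitFrom j n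
lastDigitFrom-findTop zero n = refl
lastDigitFrom-findTop (suc j) n with a (suc j) ℕ.≤ᵇ n in a≤ᵇn
... | true = refl
... | false = trans (lastDigitFrom-findTop j n) (sym (lastDigitFrom-suc-small j n<a))
  where
  n<a : n ℕ.< a (suc j)
  n<a = ℕₚ.≰⇒> λ a≤n → subst T a≤ᵇn (ℕₚ.≤⇒≤ᵇ a≤n)

lastDigit-rep : ∀ n → lastDigit (rep n) ≡ lastDigitFrom n n
lastDigit-rep zero = refl
lastDigit-rep (suc n) = trans (lastDigit-digitsFrom (top (suc n)) (suc n)) (lastDigitFrom-findTop (suc n) (suc n))

shifted : ℕ → ℕ → ℕ
shifted zero r = r
shifted (suc j) r = digit (suc j) r ℕ.* a j ℕ.+ shifted j (rest (suc j) r)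

err : ℕ → ℕ → Seq
err j r = shifted j r · φ² ⊖ r · one

err-suc : ∀ j r → err (suc j) r ≗ digit (suc j) r · δ j ⊕ err j (rest (suc j) r)
err-suc j r i = begin
  + (q ℕ.* a j ℕ.+ S) * φ² i - + r * one i
    ≡⟨ cong₂ (λ x y → x * φ² i - y * one i) S-cast r-cast ⟩
  (+ q * + a j + + S) * φ² i - (+ r′ + + q * + a (suc j)) * one i
    ≡⟨ identity (+ q) (+ a j) (+ a (suc j)) (+ S) (+ r′) (φ² i) (one i) ⟩
  + q * (+ a j * φ² i - + a (suc j) * one i) + (+ S * φ² i - + r′ * one i)
    ≡⟨ cong (λ x → + q * x + (+ S * φ² i - + r′ * one i)) (δ-gap j i) ⟨
  + q * δ j i + (+ S * φ² i - + r′ * one i) ∎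
  where
  open ≡-Reasoning
  q = digit (suc j) r
  r′ = rest (suc j) r
  S = shifted j r′
  S-cast : + (q ℕ.* a j ℕ.+ S) ≡ + q * + a j + + S
  S-cast = trans (ℤₚ.pos-+ (q ℕ.* a j) S) (cong (_+ + S) (ℤₚ.pos-* q (a j)))
  r-cast : + r ≡ + r′ + + q * + a (suc j)
  r-cast = trans (cong +_ (rest+digit (suc j) r))
    (trans (ℤₚ.pos-+ r′ (q ℕ.* a (suc j))) (cong (_+_ (+ r′)) (ℤₚ.pos-* q (a (suc j)))))
  identity : ∀ q A A′ S r′ p o → (q * A + S) * p - (r′ + q * A′) * o ≡ q * (A * p - A′ * o) + (S * p - r′ * o)
  identity = ℤ-Solver.solve-∀

NextNonZend : ℕ → ℕ → ℕ → Set
NextNonZend N j r = suc r ℕ.< N × lastDigitFrom j (suc r) ≢ 0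

NextNonZend-suc : ∀ {N N′ j} r → N ℕ.≤ a (suc j) →
  (suc (rest (suc j) r) ℕ.< a (suc j) → suc r ℕ.< N′ ⇔ suc (rest (suc j) r) ℕ.< N) →
  NextNonZend N′ (suc j) r ⇔ NextNonZend N j (rest (suc j) r)
NextNonZend-suc {N} {N′} {j} r N≤a range with suc (rest (suc j) r) ℕ.<? a (suc j)
... | yes small = mk⇔ (λ (lt , nz) → Equivalence.to (range small) lt , nz ∘ trans same)
                      (λ (lt , nz) → Equivalence.from (range small) lt , nz ∘ trans (sym same))
  where
  same : lastDigitFrom (suc j) (suc r) ≡ lastDigitFrom j (suc (rest (suc j) r))
  same = cong (lastDigitFrom j) (rest-suc (suc j) r small)
... | no large = mk⇔ (λ (_ , nz) → ⊥-elim (nz wraps)) (λ (lt , _) → ⊥-elim (large (ℕₚ.<-≤-trans lt N≤a)))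
  where
  wraps : lastDigitFrom (suc j) (suc r) ≡ 0
  wraps = trans (cong (lastDigitFrom j) (rest-suc-wrap (suc j) r r′+1≡a)) (lastDigitFrom-zero j)
    where
    r′+1≡a = ℕₚ.≤-antisym (rest<a (suc j) r) (ℕₚ.≮⇒≥ large)

-- The error of r lies in [0, 1), [1, φ) or [φ, φ²) according as r is a non-volatile zend, a volatile
-- zend or not a zend (with its digits from index j down, and volatility judged within r < N);
-- l and h are the margins from the ends of these intervals that the induction on j has to carry.
record Bounds (N j : ℕ) (l h : Seq) (r : ℕ) : Set where
  field
    zend-nonVolatile : lastDigitFrom j r ≡ 0 → NextNonZend N j r → 0ˢ ≤ᵉ err j r × err j r ≤ᵉ one ⊖ h
    zend-volatile    : lastDigitFrom j r ≡ 0 → ¬ NextNonZend N j r → one ⊕ l ≤ᵉ err j r × err j r ≤ᵉ φ ⊖ h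
    nonZend          : lastDigitFrom j r ≢ 0 → φ ≤ᵉ err j r × err j r ≤ᵉ φ² ⊖ h

≤-by-sum : ∀ {i j a₁ b₁ a₂ b₂} → j - i ≡ (b₁ - a₁) + (b₂ - a₂) → a₁ ≤ b₁ → a₂ ≤ b₂ → i ≤ j
≤-by-sum eq a₁≤b₁ a₂≤b₂ =
  ℤₚ.0≤i-j⇒j≤i (subst (0ℤ ≤_) (sym eq) (ℤₚ.+-mono-≤ (ℤₚ.i≤j⇒0≤j-i a₁≤b₁) (ℤₚ.i≤j⇒0≤j-i a₂≤b₂)))

module _ (D X : Seq) where

  ≤ᵉ-⊕ˡ : ∀ {L} → 0ˢ ≤ᵉ D → L ≤ᵉ X → L ≤ᵉ D ⊕ X
  ≤ᵉ-⊕ˡ {L} = zipWithᵉ λ {i} → ≤-by-sum (identity (D i) (X i) (L i))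
    where
    identity : ∀ d x l → d + x - l ≡ (d - 0ℤ) + (x - l)
    identity = ℤ-Solver.solve-∀

  one⊕-≤ᵉ-⊕ : ∀ l l′ → l′ ≤ᵉ l ⊕ D → one ⊕ l ≤ᵉ X → one ⊕ l′ ≤ᵉ D ⊕ X
  one⊕-≤ᵉ-⊕ l l′ = zipWithᵉ λ {i} → ≤-by-sum (identity (D i) (X i) (one i) (l i) (l′ i))
    where
    identity : ∀ d x o l l′ → d + x - (o + l′) ≡ (l + d - l′) + (x - (o + l))
    identity = ℤ-Solver.solve-∀

  ⊕-≤ᵉ-⊖ : ∀ U h h′ → h′ ⊕ D ≤ᵉ h → X ≤ᵉ U ⊖ h → D ⊕ X ≤ᵉ U ⊖ h′
  ⊕-≤ᵉ-⊖ U h h′ = zipWithᵉ λ {i} → ≤-by-sum (identity (D i) (X i) (U i) (h i) (h′ i))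
    where
    identity : ∀ d x u h h′ → u - h′ - (d + x) ≡ (h - (h′ + d)) + (u - h - x)
    identity = ℤ-Solver.solve-∀

·-nonneg : ∀ k → 0ˢ ≤ᵉ X → 0ˢ ≤ᵉ k · X
·-nonneg {X} k = mapᵉ λ {i} 0≤x → subst (_≤ + k * X i) (ℤₚ.*-zeroʳ (+ k)) (ℤₚ.*-monoˡ-≤-nonNeg (+ k) 0≤x)

Bounds-suc : ∀ {N N′ j l h l′ h′} q r → digit (suc j) r ≡ q → N ℕ.≤ a (suc j) →
  (suc (rest (suc j) r) ℕ.< a (suc j) → suc r ℕ.< N′ ⇔ suc (rest (suc j) r) ℕ.< N) →
  l′ ≤ᵉ l ⊕ q · δ j → h′ ⊕ q · δ j ≤ᵉ h →
  Bounds N j l h (rest (suc j) r) → Bounds N′ (suc j) l′ h′ r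
Bounds-suc {N} {N′} {j} {l} {h} {l′} {h′} q r digit≡q N≤a range l-margin h-margin b = record
  { zend-nonVolatile = λ z next →
      map shift-lower (shift-upper one) (B.zend-nonVolatile z (Equivalence.to next⇔ next))
  ; zend-volatile = λ z ¬next →
      map shift-lower-margin (shift-upper φ) (B.zend-volatile z (¬next ∘ Equivalence.from next⇔))
  ; nonZend = λ nz →
      map shift-lower (shift-upper φ²) (B.nonZend nz)
  }
  where
  module B = Bounds b
  r′ = rest (suc j) r
  D = q · δ j
  E′ = err j r′
  next⇔ : NextNonZend N′ (suc j) r ⇔ NextNonZend N j r′
  next⇔ = NextNonZend-suc {j = j} r N≤a range
  err≗ : err (suc j) r ≗ D ⊕ E′
  err≗ i = trans (err-suc j r i) (cong (λ x → + x * δ j i + E′ i) digit≡q)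
  shift-lower : ∀ {L} → L ≤ᵉ E′ → L ≤ᵉ err (suc j) r
  shift-lower L≤E′ = ≤ᵉ-trans (≤ᵉ-⊕ˡ D E′ (·-nonneg q (<ᵉ⇒≤ᵉ (δ-pos j))) L≤E′) (≤ᵉ-reflexive (sym ∘ err≗))
  shift-lower-margin : one ⊕ l ≤ᵉ E′ → one ⊕ l′ ≤ᵉ err (suc j) r
  shift-lower-margin ≤E′ = ≤ᵉ-trans (one⊕-≤ᵉ-⊕ D E′ l l′ l-margin ≤E′) (≤ᵉ-reflexive (sym ∘ err≗))
  shift-upper : ∀ U → E′ ≤ᵉ U ⊖ h → err (suc j) r ≤ᵉ U ⊖ h′
  shift-upper U E′≤ = ≤ᵉ-trans (≤ᵉ-reflexive err≗) (⊕-≤ᵉ-⊖ D E′ U h h′ h-margin E′≤)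

≤ᵉ-by-margin : ∀ G → 0ˢ ≤ᵉ G → (∀ i → Y i - X i ≡ G i) → X ≤ᵉ Y
≤ᵉ-by-margin {Y} {X} G 0≤G Y-X≡G =
  mapᵉ (λ {i} 0≤g → ℤₚ.0≤i-j⇒j≤i (subst (0ℤ ≤_) (sym (Y-X≡G i)) 0≤g)) 0≤G

0≤ᵉ0 : 0ˢ ≤ᵉ 0ˢ
0≤ᵉ0 = always λ _ → ℤₚ.≤-refl

range-below : ∀ {m M n N} → (m ℕ.< M → n ℕ.< N) → m ℕ.< M → n ℕ.< N ⇔ m ℕ.< M
range-below m<M⇒n<N m<M = mk⇔ (λ _ → m<M) (λ _ → m<M⇒n<N m<M)

range-shift : ∀ {m n M N} k → n ≡ m ℕ.+ k → N ≡ M ℕ.+ k → n ℕ.< N ⇔ m ℕ.< M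
range-shift k refl refl = mk⇔ (ℕₚ.+-cancelʳ-< k _ _) (ℕₚ.+-monoˡ-< k)

-- Remainders below a (j+1) - a j = F(2j+2), the only ones that can follow a digit 2 at index j+1,
-- carry the larger upper margin ε j ⊕ δ j, which absorbs the two extra copies of δ j; in exchange
-- their lower margin is negative.
FullBounds ShortBounds : ℕ → Set
FullBounds j = ∀ r → r ℕ.< a (suc j) → Bounds (a (suc j)) j 0ˢ (ε j) r
ShortBounds j = ∀ r → r ℕ.< evenFib (suc j) → Bounds (evenFib (suc j)) j (0ˢ ⊖ ε j) (ε j ⊕ δ j) r

FullBounds-zero : FullBounds 0
FullBounds-zero 0 _ = record
  { zend-nonVolatile = λ _ _ → ≤ᵉ-reflexive (λ i → zero-err (φ i) (one i))
                              , ≤ᵉ-reflexive (λ i → zero-err-upper (φ i) (one i))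
  ; zend-volatile    = λ _ ¬next → ⊥-elim (¬next (ℕₚ.≤-refl , λ ()))
  ; nonZend          = λ nz → ⊥-elim (nz refl)
  }
  where
  zero-err : ∀ f o → 0ℤ ≡ + 0 * (f + o) - + 0 * o
  zero-err = ℤ-Solver.solve-∀
  zero-err-upper : ∀ f o → + 0 * (f + o) - + 0 * o ≡ o - o
  zero-err-upper = ℤ-Solver.solve-∀
FullBounds-zero 1 _ = record
  { zend-nonVolatile = λ ()
  ; zend-volatile    = λ ()
  ; nonZend          = λ _ → ≤ᵉ-reflexive (λ i → one-err (φ i) (one i))
                            , ≤ᵉ-reflexive (λ i → one-err-upper (φ i) (one i))
  }
  where
  one-err : ∀ f o → f ≡ + 1 * (f + o) - + 1 * o
  one-err = ℤ-Solver.solve-∀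
  one-err-upper : ∀ f o → + 1 * (f + o) - + 1 * o ≡ f + o - o
  one-err-upper = ℤ-Solver.solve-∀
FullBounds-zero (suc (suc r)) (s≤s (s≤s ()))

ShortBounds-zero : ShortBounds 0
ShortBounds-zero 0 _ = record
  { zend-nonVolatile = λ _ (1<1 , _) → ⊥-elim (ℕₚ.<-irrefl refl 1<1)
  ; zend-volatile    = λ _ _ → ≤ᵉ-reflexive (λ i → lower (φ i) (one i))
                              , ≤ᵉ-reflexive (λ i → upper (φ i) (one i))
  ; nonZend          = λ nz → ⊥-elim (nz refl)
  }
  where
  lower : ∀ f o → o + (0ℤ - o) ≡ + 0 * (f + o) - + 0 * o
  lower = ℤ-Solver.solve-∀
  upper : ∀ f o → + 0 * (f + o) - + 0 * o ≡ f - (o + (f - o))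
  upper = ℤ-Solver.solve-∀
ShortBounds-zero (suc r) (s≤s ())

digit-split : ∀ j {r q} → digit j r ≡ q → r ≡ rest j r ℕ.+ q ℕ.* a j
digit-split j {r} digit≡q = trans (rest+digit j r) (cong (λ x → rest j r ℕ.+ x ℕ.* a j) digit≡q)

FullBounds-suc : ∀ j → FullBounds j → ShortBounds j → FullBounds (suc j)
FullBounds-suc j full short r r<C = by-digit (digit (suc j) r) refl
  where
  A = a (suc j)
  C = a (suc (suc j))
  r′ = rest (suc j) r
  lower₀ : ∀ d → 0ℤ + + 0 * d - 0ℤ ≡ 0ℤ
  lower₀ = ℤ-Solver.solve-∀
  upper₀ : ∀ e d → e - (e - d + + 0 * d) ≡ d
  upper₀ = ℤ-Solver.solve-∀
  lower₁ : ∀ d → 0ℤ + + 1 * d - 0ℤ ≡ d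
  lower₁ = ℤ-Solver.solve-∀
  upper₁ : ∀ e d → e - (e - d + + 1 * d) ≡ 0ℤ
  upper₁ = ℤ-Solver.solve-∀
  lower₂ : ∀ e d → (0ℤ - e) + + 2 * d - 0ℤ ≡ d - (e - d)
  lower₂ = ℤ-Solver.solve-∀
  upper₂ : ∀ e d → (e + d) - (e - d + + 2 * d) ≡ 0ℤ
  upper₂ = ℤ-Solver.solve-∀
  by-digit : ∀ q → digit (suc j) r ≡ q → Bounds C (suc j) 0ˢ (ε (suc j)) r
  by-digit 0 digit≡q = Bounds-suc 0 r digit≡q ℕₚ.≤-refl (range-below below-C)
              (≤ᵉ-by-margin 0ˢ 0≤ᵉ0 λ i → lower₀ (δ j i))
              (≤ᵉ-by-margin (δ j) (<ᵉ⇒≤ᵉ (δ-pos j)) λ i → upper₀ (ε j i) (δ j i))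
              (full r′ (rest<a (suc j) r))
    where
    below-C : suc r′ ℕ.< A → suc r ℕ.< C
    below-C small = subst (λ x → suc x ℕ.< C)
      (sym (trans (digit-split (suc j) digit≡q) (ℕₚ.+-identityʳ r′))) (ℕₚ.<-trans small (a-<-suc (suc j)))
  by-digit 1 digit≡q = Bounds-suc 1 r digit≡q ℕₚ.≤-refl (range-below below-C)
              (≤ᵉ-by-margin (δ j) (<ᵉ⇒≤ᵉ (δ-pos j)) λ i → lower₁ (δ j i))
              (≤ᵉ-by-margin 0ˢ 0≤ᵉ0 λ i → upper₁ (ε j i) (δ j i))
              (full r′ (rest<a (suc j) r))
    where
    below-C : suc r′ ℕ.< A → suc r ℕ.< C
    below-C small = begin-strict
      suc r                     ≡⟨ cong suc (digit-split (suc j) digit≡q) ⟩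
      suc r′ ℕ.+ 1 ℕ.* A        ≡⟨ cong (suc r′ ℕ.+_) (ℕₚ.*-identityˡ A) ⟩
      suc r′ ℕ.+ A              <⟨ ℕₚ.+-monoˡ-< A small ⟩
      A ℕ.+ A                   ≤⟨ ℕₚ.m≤n+m (A ℕ.+ A) (evenFib (suc j)) ⟩
      evenFib (suc j) ℕ.+ (A ℕ.+ A) ≡⟨ cong (λ x → evenFib (suc j) ℕ.+ (A ℕ.+ x)) (ℕₚ.+-identityʳ A) ⟨
      evenFib (suc j) ℕ.+ 2 ℕ.* A   ≡⟨ a-suc-suc j ⟨
      C                         ∎
      where open ℕₚ.≤-Reasoning
  by-digit 2 digit≡q = Bounds-suc 2 r digit≡q (evenFib≤a (suc j))
              (λ _ → range-shift (2 ℕ.* A) (cong suc (digit-split (suc j) digit≡q)) (a-suc-suc j))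
              (≤ᵉ-by-margin (δ (suc j)) (<ᵉ⇒≤ᵉ (δ-pos (suc j))) λ i → lower₂ (ε j i) (δ j i))
              (≤ᵉ-by-margin 0ˢ 0≤ᵉ0 λ i → upper₂ (ε j i) (δ j i))
              (short r′ (ℕₚ.+-cancelʳ-< (2 ℕ.* A) r′ (evenFib (suc j))
                           (subst₂ ℕ._<_ (digit-split (suc j) digit≡q) (a-suc-suc j) r<C)))
  by-digit (suc (suc (suc q))) digit≡q = ⊥-elim (ℕₚ.<⇒≱ r<C (begin
      C                                   ≡⟨ a-suc-suc j ⟩
      evenFib (suc j) ℕ.+ 2 ℕ.* A         ≤⟨ ℕₚ.+-monoˡ-≤ (2 ℕ.* A) (evenFib≤a (suc j)) ⟩
      3 ℕ.* A                             ≤⟨ ℕₚ.*-monoˡ-≤ A (ℕₚ.m≤m+n 3 q) ⟩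
      (3 ℕ.+ q) ℕ.* A                     ≤⟨ ℕₚ.m≤n+m _ r′ ⟩
      r′ ℕ.+ (3 ℕ.+ q) ℕ.* A              ≡⟨ digit-split (suc j) digit≡q ⟨
      r                                   ∎))
    where open ℕₚ.≤-Reasoning

ShortBounds-suc : ∀ j → FullBounds j → ShortBounds j → ShortBounds (suc j)
ShortBounds-suc j full short r r<N = by-digit (digit (suc j) r) refl
  where
  A = a (suc j)
  N = evenFib (suc (suc j))
  r′ = rest (suc j) r
  N≡e+A : N ≡ evenFib (suc j) ℕ.+ 1 ℕ.* A
  N≡e+A = trans (evenFib-suc (suc j)) (trans (ℕₚ.+-comm A _) (cong (evenFib (suc j) ℕ.+_) (sym (ℕₚ.*-identityˡ A))))
  lower₀ : ∀ e d → 0ℤ + + 0 * d - (0ℤ - (e - d)) ≡ e - d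
  lower₀ = ℤ-Solver.solve-∀
  upper₀ : ∀ e d → e - (e - d + (d - (e - d)) + + 0 * d) ≡ e - d
  upper₀ = ℤ-Solver.solve-∀
  lower₁ : ∀ e d → (0ℤ - e) + + 1 * d - (0ℤ - (e - d)) ≡ 0ℤ
  lower₁ = ℤ-Solver.solve-∀
  upper₁ : ∀ e d → (e + d) - (e - d + (d - (e - d)) + + 1 * d) ≡ e - d
  upper₁ = ℤ-Solver.solve-∀
  by-digit : ∀ q → digit (suc j) r ≡ q → Bounds N (suc j) (0ˢ ⊖ ε (suc j)) (ε (suc j) ⊕ δ (suc j)) r
  by-digit 0 digit≡q = Bounds-suc 0 r digit≡q ℕₚ.≤-refl (range-below below-N)
              (≤ᵉ-by-margin (ε (suc j)) (<ᵉ⇒≤ᵉ (ε-pos (suc j))) λ i → lower₀ (ε j i) (δ j i))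
              (≤ᵉ-by-margin (ε (suc j)) (<ᵉ⇒≤ᵉ (ε-pos (suc j))) λ i → upper₀ (ε j i) (δ j i))
              (full r′ (rest<a (suc j) r))
    where
    below-N : suc r′ ℕ.< A → suc r ℕ.< N
    below-N small = subst₂ (λ x y → suc x ℕ.< y)
      (sym (trans (digit-split (suc j) digit≡q) (ℕₚ.+-identityʳ r′))) (sym (evenFib-suc (suc j)))
      (ℕₚ.<-≤-trans small (ℕₚ.m≤m+n A (evenFib (suc j))))
  by-digit 1 digit≡q = Bounds-suc 1 r digit≡q (evenFib≤a (suc j))
              (λ _ → range-shift (1 ℕ.* A) (cong suc (digit-split (suc j) digit≡q)) N≡e+A)
              (≤ᵉ-by-margin 0ˢ 0≤ᵉ0 λ i → lower₁ (ε j i) (δ j i))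
              (≤ᵉ-by-margin (ε (suc j)) (<ᵉ⇒≤ᵉ (ε-pos (suc j))) λ i → upper₁ (ε j i) (δ j i))
              (short r′ (ℕₚ.+-cancelʳ-< (1 ℕ.* A) r′ (evenFib (suc j))
                           (subst₂ ℕ._<_ (digit-split (suc j) digit≡q) N≡e+A r<N)))
  by-digit (suc (suc q)) digit≡q = ⊥-elim (ℕₚ.<⇒≱ r<N (begin
      N                                   ≡⟨ evenFib-suc (suc j) ⟩
      A ℕ.+ evenFib (suc j)               ≤⟨ ℕₚ.+-monoʳ-≤ A (ℕₚ.≤-trans (evenFib≤a (suc j)) (ℕₚ.m≤m+n A 0)) ⟩
      2 ℕ.* A                             ≤⟨ ℕₚ.*-monoˡ-≤ A (ℕₚ.m≤m+n 2 q) ⟩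
      (2 ℕ.+ q) ℕ.* A                     ≤⟨ ℕₚ.m≤n+m _ r′ ⟩
      r′ ℕ.+ (2 ℕ.+ q) ℕ.* A              ≡⟨ digit-split (suc j) digit≡q ⟨
      r                                   ∎))
    where open ℕₚ.≤-Reasoning

bounds : ∀ j → FullBounds j × ShortBounds j
bounds zero = FullBounds-zero , ShortBounds-zero
bounds (suc j) = let (full , short) = bounds j in FullBounds-suc j full short , ShortBounds-suc j full short

-- Consecutive multiples of p ≥ 0 are p apart, so s p cannot lie in [n o + o, n o + p)
-- when m p lies in [n o, n o + o).
no-multiple-between : ∀ {o p : ℤ} {s m n : ℕ} → 0ℤ ≤ p →
  o ≤ + s * p - + n * o → + s * p - + n * o < p → + n * o ≤ + m * p → + m * p < + suc n * o → ⊥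
no-multiple-between {o} {p} {s} {m} {n} 0≤p o≤sp-no sp-no<p no≤mp mp<[1+n]o = by-cases (s ℕ.≤? m)
  where
  open ℤₚ.≤-Reasoning
  *p-mono : ∀ {x y} → x ℕ.≤ y → + x * p ≤ + y * p
  *p-mono x≤y = ℤₚ.*-monoʳ-≤-nonNeg p {{ℤ.nonNegative 0≤p}} (+≤+ x≤y)
  identity₁ : ∀ o n → (+ 1 + n) * o - n * o ≡ o
  identity₁ = ℤ-Solver.solve-∀
  identity₂ : ∀ p m x → p + (m * p - x) ≡ (+ 1 + m) * p - x
  identity₂ = ℤ-Solver.solve-∀
  by-cases : Dec (s ℕ.≤ m) → ⊥
  by-cases (yes s≤m) = ℤₚ.<-irrefl refl (begin-strict
    o                          ≤⟨ o≤sp-no ⟩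
    + s * p - + n * o          ≤⟨ ℤₚ.+-monoˡ-≤ (ℤ.- (+ n * o)) (*p-mono s≤m) ⟩
    + m * p - + n * o          <⟨ ℤₚ.+-monoˡ-< (ℤ.- (+ n * o)) mp<[1+n]o ⟩
    + suc n * o - + n * o      ≡⟨ cong (λ x → x * o - + n * o) (ℤₚ.pos-+ 1 n) ⟩
    (+ 1 + + n) * o - + n * o  ≡⟨ identity₁ o (+ n) ⟩
    o                          ∎)
  by-cases (no s≰m) = ℤₚ.<-irrefl refl (begin-strict
    p                          ≡⟨ ℤₚ.+-identityʳ p ⟨
    p + 0ℤ                     ≤⟨ ℤₚ.+-monoʳ-≤ p (ℤₚ.i≤j⇒0≤j-i no≤mp) ⟩
    p + (+ m * p - + n * o)    ≡⟨ identity₂ p (+ m) (+ n * o) ⟩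
    (+ 1 + + m) * p - + n * o  ≡⟨ cong (λ x → x * p - + n * o) (ℤₚ.pos-+ 1 m) ⟨
    + suc m * p - + n * o      ≤⟨ ℤₚ.+-monoˡ-≤ (ℤ.- (+ n * o)) (*p-mono (ℕₚ.≰⇒> s≰m)) ⟩
    + s * p - + n * o          <⟨ sp-no<p ⟩
    p                          ∎)

¬floor-from-error : ∀ s m n → one ≤ᵉ s · φ² ⊖ n · one → s · φ² ⊖ n · one <ᵉ φ² →
                    ¬ (n · one ≤ᵉ m · φ² × m · φ² <ᵉ suc n · one)
¬floor-from-error s m n lower upper (n≤m , m<n+1) =
  never (λ {i} ((lo , hi) , (le , lt)) → no-multiple-between {one i} {φ² i} {s} {m} {n} (+≤+ z≤n) lo hi le lt)
        (zipWithᵉ _,_ (zipWithᵉ _,_ lower upper) (zipWithᵉ _,_ n≤m m<n+1))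

<-by-margin : ∀ {x y o h} → 0ℤ < h → x - y ≤ o - h → x < o + y
<-by-margin {x} {y} {o} {h} 0<h x-y≤o-h = begin-strict
  x               ≡⟨ identity x y ⟩
  x - y + y       ≤⟨ ℤₚ.+-monoˡ-≤ y x-y≤o-h ⟩
  o - h + y       <⟨ ℤₚ.+-monoˡ-< y (ℤₚ.+-monoʳ-< o (ℤₚ.neg-mono-< 0<h)) ⟩
  o + 0ℤ + y      ≡⟨ cong (_+ y) (ℤₚ.+-identityʳ o) ⟩
  o + y           ∎
  where
  open ℤₚ.≤-Reasoning
  identity : ∀ x y → x ≡ x - y + y
  identity = ℤ-Solver.solve-∀

floor-from-error : ∀ s n {h} → 0ˢ <ᵉ h → 0ˢ ≤ᵉ s · φ² ⊖ n · one → s · φ² ⊖ n · one ≤ᵉ one ⊖ h →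
                   n · one ≤ᵉ s · φ² × s · φ² <ᵉ suc n · one
floor-from-error s n 0<h lower upper =
  mapᵉ ℤₚ.0≤i-j⇒j≤i lower ,
  zipWithᵉ (λ {i} 0<hᵢ e≤o-h → subst (+ s * φ² i <_) (suc-multiple (one i)) (<-by-margin {o = one i} 0<hᵢ e≤o-h))
           0<h upper
  where
  suc-multiple : ∀ o → o + + n * o ≡ + suc n * o
  suc-multiple o = trans (identity o (+ n)) (cong (_* o) (sym (ℤₚ.pos-+ 1 n)))
    where
    identity : ∀ o n → o + n * o ≡ (+ 1 + n) * o
    identity = ℤ-Solver.solve-∀

one≤ᵉφ : one ≤ᵉ φ
one≤ᵉφ = always λ i → +≤+ (evenFib≤a i)

φ≤ᵉφ² : φ ≤ᵉ φ²
φ≤ᵉφ² = always λ i → +≤+ (ℕₚ.m≤m+n (a i) (evenFib i))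

⊖-<ᵉ : 0ˢ <ᵉ Y → X ⊖ Y <ᵉ X
⊖-<ᵉ {Y} {X} = mapᵉ λ {i} 0<y → subst (X i - Y i <_) (ℤₚ.+-identityʳ (X i)) (ℤₚ.+-monoʳ-< (X i) (ℤₚ.neg-mono-< 0<y))

zend-nonVolatile⇒IsFloorMulPhiSq : ∀ {N j l h r} → 0ˢ <ᵉ h → Bounds N j l h r →
  lastDigitFrom j r ≡ 0 → NextNonZend N j r → IsFloorMulPhiSq r (shifted j r)
zend-nonVolatile⇒IsFloorMulPhiSq {j = j} {r = r} 0<h b zend next =
  let (lower , upper) = Bounds.zend-nonVolatile b zend next
  in Equivalence.from (IsFloorMulPhiSq⇔ r (shifted j r)) (floor-from-error (shifted j r) r 0<h lower upper)

IsFloorMulPhiSq⇒zend-nonVolatile : ∀ {N j h r} m → 0ˢ <ᵉ h → Bounds N j 0ˢ h r → IsFloorMulPhiSq r m →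
  lastDigitFrom j r ≡ 0 × lastDigitFrom j (suc r) ≢ 0
IsFloorMulPhiSq⇒zend-nonVolatile {j = j} {r = r} m 0<h b isFloor = zend , λ next-zend →
  let (lower , upper) = zend-volatile zend (λ (_ , nz) → nz next-zend)
  in excluded (≤ᵉ-trans (≤ᵉ-reflexive (λ i → sym (ℤₚ.+-identityʳ (one i)))) lower)
              (≤ᵉ-<ᵉ-trans upper (<ᵉ-≤ᵉ-trans (⊖-<ᵉ 0<h) φ≤ᵉφ²))
  where
  open Bounds b
  excluded : one ≤ᵉ err j r → err j r <ᵉ φ² → ⊥
  excluded lower upper =
    ¬floor-from-error (shifted j r) m r lower upper (Equivalence.to (IsFloorMulPhiSq⇔ r m) isFloor)
  zend : lastDigitFrom j r ≡ 0
  zend with lastDigitFrom j r ℕ.≟ 0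
  ... | yes z = z
  ... | no nz = let (lower , upper) = nonZend nz
                in ⊥-elim (excluded (≤ᵉ-trans one≤ᵉφ lower) (≤ᵉ-<ᵉ-trans upper (⊖-<ᵉ 0<h)))

proposition5p16 : (n : ℕ) → InWU n ⇔ (Zend n × NonVolatile n)
proposition5p16 n = mk⇔
  (λ (m , isFloor) →
     let (zend , nonVolatile) = IsFloorMulPhiSq⇒zend-nonVolatile m (ε-pos J) bounds-n isFloor
     in trans zend≡ zend , nonVolatile ∘ trans (sym next≡))
  (λ (zend , nonVolatile) →
     shifted J n , zend-nonVolatile⇒IsFloorMulPhiSq (ε-pos J) bounds-n (trans (sym zend≡) zend)
                                                     (suc-n<a , nonVolatile ∘ trans next≡))
  where
  J = suc n
  suc-n<a : suc n ℕ.< a (suc J)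
  suc-n<a = ℕₚ.<-trans (ℕₚ.n<1+n (suc n)) (<a (suc J))
  bounds-n : Bounds (a (suc J)) J 0ˢ (ε J) n
  bounds-n = proj₁ (bounds J) n (ℕₚ.<-trans (ℕₚ.n<1+n n) suc-n<a)
  zend≡ : lastDigit (rep n) ≡ lastDigitFrom J n
  zend≡ = trans (lastDigit-rep n) (sym (lastDigitFrom-suc-small n (ℕₚ.<-trans (ℕₚ.n<1+n n) (<a (suc n)))))
  next≡ : lastDigit (rep (suc n)) ≡ lastDigitFrom J (suc n)
  next≡ = lastDigit-rep (suc n)
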